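{- If $(\mathcal{C},\mathcal{K})$ is a connective island domain, then a subfamily of $\mathcal{C}$ is a system of pre-islands corresponding to $(\mathcal{C},\mathcal{K})$ if and only if it is admissible.
   Context: An island domain is a pair $(\mathcal{C},\mathcal{K})$ where $U$ is a nonempty finite set and $\mathcal{C}\subseteq\mathcal{K}\subseteq\mathcal{P}(U)$ with $U\in\mathcal{C}$. It is connective if for all $A,B\in\mathcal{C}$ with $A\cap B\neq\emptyset$ and $B\not\subseteq A$ there exists $K\in\mathcal{K}$ with $A\subsetneq K\subseteq A\cup B$. A height function is any map $h\colon U\to\mathbb{R}$. Let $\prec$ denote the cover relation of the poset $(\mathcal{K},\subseteq)$. For a nonempty $S\in\mathcal{C}$, $S$ is a pre-island with respect to $(\mathcal{C},\mathcal{K},h)$ if every $K\in\mathcal{K}$ with $S\prec K$ satisfies $\min h(K)<\min h(S)$. A system of pre-islands corresponding to $(\mathcal{C},\mathcal{K})$ is a family that equals, for some height function $h$, the set of all nonempty $S\in\mathcal{C}$ that are pre-islands with respect to $(\mathcal{C},\mathcal{K},h)$. A family $\mathcal{H}\subseteq\mathcal{C}\setminus\{\emptyset\}$ with $U\in\mathcal{H}$ is admissible if for every nonempty antichain $\mathcal{A}\subseteq\mathcal{H}$ there is $H\in\mathcal{A}$ such that for all $K\in\mathcal{K}$, $H\subsetneq K$ implies $K\not\subseteq\bigcup\mathcal{A}$.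
   Formalization: Height functions on U take values in ℚ rather than ℝ. -}

module Defs where

open import Data.Nat using (ℕ; zero; suc)
open import Data.Bool using (Bool; true; false; T)
open import Data.Fin using (Fin; zero; suc)
open import Data.Fin.Subset using (Subset; _∈_; _⊆_; _⊂_; _∩_; _∪_; ⊤; Nonempty; inside; outside)
open import Data.Vec using (_∷_; [])
open import Data.Maybe using (Maybe; just; nothing)
open import Data.Rational using (ℚ; _<_; _⊓_)
open import Data.Product using (Σ; _×_; ∃-syntax)
open import Data.Empty using (⊥)
open import Relation.Nullary using (¬_)
open import Relation.Binary.PropositionalEquality using (_≡_)
open import Function using (_∘_)
open import Function.Bundles using (_⇔_)

-- The universe U is Fin n (nonemptiness imposed in the theorem).
-- A family of subsets of U (an element of P(P(U))) is given by its
-- (decidable) characteristic function.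
Family : ℕ → Set
Family n = Subset n → Bool

infix 4 _∈ᶠ_ _⊆ᶠ_

_∈ᶠ_ : ∀ {n} → Subset n → Family n → Set
S ∈ᶠ F = T (F S)

_⊆ᶠ_ : ∀ {n} → Family n → Family n → Set
F ⊆ᶠ G = ∀ S → S ∈ᶠ F → S ∈ᶠ G

_⊆⋃_ : ∀ {n} → Subset n → Family n → Set
K ⊆⋃ 𝒜 = ∀ x → x ∈ K → ∃[ A ] (A ∈ᶠ 𝒜 × x ∈ A)

IsIslandDomain : ∀ {n} → Family n → Family n → Set
IsIslandDomain 𝒞 𝒦 = (𝒞 ⊆ᶠ 𝒦) × (⊤ ∈ᶠ 𝒞)

IsConnective : ∀ {n} → Family n → Family n → Set
IsConnective 𝒞 𝒦 =
  ∀ A B → A ∈ᶠ 𝒞 → B ∈ᶠ 𝒞 → Nonempty (A ∩ B) → ¬ (B ⊆ A) →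
  ∃[ K ] (K ∈ᶠ 𝒦 × A ⊂ K × K ⊆ A ∪ B)

Covers : ∀ {n} → Family n → Subset n → Subset n → Set
Covers 𝒦 S K =
  S ∈ᶠ 𝒦 × K ∈ᶠ 𝒦 × S ⊂ K × (∀ K′ → K′ ∈ᶠ 𝒦 → S ⊂ K′ → ¬ (K′ ⊂ K))

minMaybe : Maybe ℚ → Maybe ℚ → Maybe ℚ
minMaybe (just a) (just b) = just (a ⊓ b)
minMaybe (just a) nothing = just a
minMaybe nothing m = m

minH : ∀ {n} → (Fin n → ℚ) → Subset n → Maybe ℚ
minH h [] = nothing
minH h (inside ∷ p) = minMaybe (just (h zero)) (minH (h ∘ suc) p)
minH h (outside ∷ p) = minH (h ∘ suc) p

-- strict comparison of minima (both sets are nonempty where used)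
_<ₘ_ : Maybe ℚ → Maybe ℚ → Set
just a <ₘ just b = a < b
_ <ₘ _ = ⊥

IsPreIsland : ∀ {n} → Family n → Family n → (Fin n → ℚ) → Subset n → Set
IsPreIsland 𝒞 𝒦 h S =
  S ∈ᶠ 𝒞 × Nonempty S ×
  (∀ K → K ∈ᶠ 𝒦 → Covers 𝒦 S K → minH h K <ₘ minH h S)

IsSystemOfPreIslands : ∀ {n} → Family n → Family n → Family n → Set
IsSystemOfPreIslands 𝒞 𝒦 ℋ =
  ∃[ h ] (∀ S → (S ∈ᶠ ℋ) ⇔ IsPreIsland 𝒞 𝒦 h S)

IsAntichain : ∀ {n} → Family n → Set
IsAntichain 𝒜 = ∀ A B → A ∈ᶠ 𝒜 → B ∈ᶠ 𝒜 → A ⊆ B → A ≡ B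

IsAdmissible : ∀ {n} → Family n → Family n → Family n → Set
IsAdmissible {n} 𝒞 𝒦 ℋ =
  (∀ S → S ∈ᶠ ℋ → S ∈ᶠ 𝒞 × Nonempty S) × (⊤ ∈ᶠ ℋ) ×
  (∀ (𝒜 : Family n) → 𝒜 ⊆ᶠ ℋ → IsAntichain 𝒜 → (∃[ A ] (A ∈ᶠ 𝒜)) →
     ∃[ H ] (H ∈ᶠ 𝒜 × (∀ K → K ∈ᶠ 𝒦 → H ⊂ K → ¬ (K ⊆⋃ 𝒜))))

{-# OPTIONS --safe #-}
module Submission where

-- The pre-islands of a height function h form an admissible family: in an antichain 𝒜 of them
-- take the member H containing a lowest point z of ⋃ 𝒜. A proper 𝒦-extension K ⊆ ⋃ 𝒜 of H
-- contains a cover of H, and the pre-island condition puts a point of that cover below z.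
--
-- Conversely, applying admissibility to the maximal members of what is left lists ℋ as
-- H₀, H₁, …, Hₖ such that no Hᵢ has a proper 𝒦-extension inside Hᵢ ∪ Hᵢ₊₁ ∪ … ∪ Hₖ. Let the
-- height of x be the largest i with x ∈ Hᵢ (U ∈ ℋ, so there is one). A proper extension of Hᵢ
-- then has a point of height < i, so each Hᵢ is a pre-island. If S is a pre-island whose lowest
-- point x has height j, no point of S ∪ Hⱼ lies below x, so by connectivity S contains Hⱼ; and
-- S ⊆ Hⱼ ∪ … ∪ Hₖ, so S ≠ Hⱼ would make S a forbidden extension of Hⱼ.

open import Defs
open import Data.Nat as ℕ using (ℕ; zero; suc; z≤n; s≤s)
import Data.Nat.Properties as ℕP
open import Data.Integer as ℤ using (+_; +<+; +≤+)
import Data.Integer.Properties as ℤP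
open import Data.Rational using (ℚ; _<_; _≤_; *<*; *≤*)
open import Data.Rational.Literals using (fromℤ)
import Data.Rational.Properties as QP
import Data.Bool.Properties as BoolP
open import Data.Fin using (Fin; zero; suc)
import Data.Fin.Properties as FinP
open import Data.Fin.Subset using (Subset; _∈_; _⊆_; _⊂_; ⊤; Nonempty; Empty; inside; outside; ∣_∣)
open import Data.Fin.Subset.Properties
  using (_∈?_; _⊆?_; _⊂?_; ⊆-antisym; ⊆-trans; p⊂q⇒∣p∣<∣q∣; ∈⊤; x∈p∩q⁺; x∈p∪q⁻; anySubset?)
open import Data.Vec using ([]; _∷_; here; there)
import Data.Vec.Properties as VecP
open import Data.List using (List; []; _∷_; map; _++_; filter; length; drop; allFin)
open import Data.List.Relation.Unary.Any as Any using (Any; here; there)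
open import Data.List.Relation.Unary.All as All using (All)
open import Data.List.Relation.Unary.All.Properties using (all-filter)
open import Data.List.Membership.Propositional using (find; lose) renaming (_∈_ to _∈ˡ_)
open import Data.List.Membership.Propositional.Properties
  using (∈-filter⁺; ∈-filter⁻; ∈-map⁺; ∈-++⁺ˡ; ∈-++⁺ʳ; ∈-allFin)
open import Data.List.Relation.Binary.Subset.Propositional using () renaming (_⊆_ to _⊆ˡ_)
open import Data.List.Relation.Binary.Subset.Propositional.Properties using (Any-resp-⊆)
import Data.List.Properties as ListP
import Data.List.Extrema.Nat as ℕExtrema
open import Data.Maybe using (just; nothing)
open import Data.Product using (_×_; _,_; proj₁; proj₂; ∃; ∃₂; ∃-syntax)
open import Data.Sum as Sum using (_⊎_; inj₁; inj₂)
open import Function using (_∘_; id)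
open import Function.Bundles using (_⇔_; mk⇔; module Equivalence)
open import Relation.Binary.Bundles using (DecTotalOrder)
open import Relation.Binary.Definitions using (DecidableEquality)
open import Relation.Binary.PropositionalEquality using (_≡_; _≢_; refl; sym; cong; subst; subst₂)
open import Relation.Nullary using (¬_; Dec; yes; no; ¬?; contradiction)
open import Relation.Nullary.Decidable
  using (_×-dec_; ⌊_⌋; toWitness; fromWitness; decidable-stable; T?)
open import Relation.Unary using (Pred; Decidable)
import Data.List.Extrema (DecTotalOrder.totalOrder QP.≤-decTotalOrder) as ℚExtrema

_≟ˢ_ : ∀ {m} → DecidableEquality (Subset m)
_≟ˢ_ = VecP.≡-dec BoolP._≟_

∃-counterexample : ∀ {m p} {P : Pred (Fin m) p} → Decidable P → (S : Subset m) →
  ¬ (∀ x → x ∈ S → P x) → ∃[ x ] (x ∈ S × ¬ P x)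
∃-counterexample P? S ¬S⊆P with FinP.any? (λ x → x ∈? S ×-dec ¬? (P? x))
... | yes found = found
... | no none =
  contradiction (λ x x∈S → decidable-stable (P? x) (λ ¬Px → none (x , x∈S , ¬Px))) ¬S⊆P

⊆∧≢⇒⊂ : ∀ {m} {p q : Subset m} → p ⊆ q → p ≢ q → p ⊂ q
⊆∧≢⇒⊂ {p = p} {q} p⊆q p≢q =
  p⊆q , ∃-counterexample (_∈? p) q (λ q⊆p → p≢q (⊆-antisym p⊆q (q⊆p _)))

subsets : ∀ m → List (Subset m)
subsets zero    = [] ∷ []
subsets (suc m) = map (inside ∷_) (subsets m) ++ map (outside ∷_) (subsets m)

∈-subsets : ∀ {m} (p : Subset m) → p ∈ˡ subsets m
∈-subsets []            = here refl
∈-subsets (inside ∷ p)  = ∈-++⁺ˡ (∈-map⁺ (inside ∷_) (∈-subsets p))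
∈-subsets (outside ∷ p) = ∈-++⁺ʳ (map (inside ∷_) (subsets _)) (∈-map⁺ (outside ∷_) (∈-subsets p))

module _ {m p} {P : Pred (Subset m) p} (P? : Decidable P) where

  private
    candidates : List (Subset m)
    candidates = filter P? (subsets m)

    ∈-candidates : ∀ {S} → P S → S ∈ˡ candidates
    ∈-candidates PS = ∈-filter⁺ P? (∈-subsets _) PS

  ⊂-minimal : ∀ {S} → P S → ∃[ M ] (P M × ∀ {M′} → P M′ → ¬ M′ ⊂ M)
  ⊂-minimal {S} PS =
    M , ℕExtrema.argmin-all ∣_∣ PS (all-filter P? (subsets m)) ,
    λ PM′ M′⊂M → ℕP.<⇒≱ (p⊂q⇒∣p∣<∣q∣ M′⊂M)
      (All.lookup (ℕExtrema.f[argmin]≤f[xs] S candidates) (∈-candidates PM′))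
    where M = ℕExtrema.argmin ∣_∣ S candidates

  ⊂-maximal : ∀ {S} → P S → ∃[ M ] (P M × ∀ {M′} → P M′ → ¬ M ⊂ M′)
  ⊂-maximal {S} PS =
    M , ℕExtrema.argmax-all ∣_∣ PS (all-filter P? (subsets m)) ,
    λ PM′ M⊂M′ → ℕP.<⇒≱ (p⊂q⇒∣p∣<∣q∣ M⊂M′)
      (All.lookup (ℕExtrema.f[xs]≤f[argmax] S candidates) (∈-candidates PM′))
    where M = ℕExtrema.argmax ∣_∣ S candidates

minimiser : ∀ {m p} (f : Fin m → ℚ) {P : Pred (Fin m) p} → Decidable P → ∃ P →
  ∃[ z ] (P z × ∀ {y} → P y → f z ≤ f y)
minimiser {m} f P? (x , Px) =
  z , ℚExtrema.argmin-all f Px (all-filter P? (allFin m)) ,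
  λ Py → All.lookup (ℚExtrema.f[argmin]≤f[xs] x candidates) (∈-filter⁺ P? (∈-allFin _) Py)
  where
  candidates = filter P? (allFin m)
  z = ℚExtrema.argmin f x candidates

minH-spec : ∀ {m} (f : Fin m → ℚ) (S : Subset m) →
  (minH f S ≡ nothing × Empty S) ⊎
  ∃[ z ] (z ∈ S × minH f S ≡ just (f z) × ∀ {y} → y ∈ S → f z ≤ f y)
minH-spec f [] = inj₁ (refl , λ ())
minH-spec f (outside ∷ p) with minH-spec (f ∘ suc) p
... | inj₁ (none , p=∅) = inj₁ (none , λ { (suc x , there x∈p) → p=∅ (x , x∈p) })
... | inj₂ (z , z∈p , eq , z-min) = inj₂ (suc z , there z∈p , eq , λ { (there y∈p) → z-min y∈p })
minH-spec f (inside ∷ p) with minH (f ∘ suc) p | minH-spec (f ∘ suc) p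
... | _ | inj₁ (refl , p=∅) =
  inj₂ (zero , here , refl , λ { here → QP.≤-refl ; (there y∈p) → contradiction (_ , y∈p) p=∅ })
... | _ | inj₂ (z , z∈p , refl , z-min) with QP.⊓-sel (f zero) (f (suc z))
...   | inj₁ eq = inj₂ (zero , here , cong just eq , λ
          { here → QP.≤-refl
          ; (there y∈p) → QP.≤-trans (subst (_≤ f (suc z)) eq (QP.p⊓q≤q (f zero) _)) (z-min y∈p) })
...   | inj₂ eq = inj₂ (suc z , there z∈p , cong just eq , λ
          { here → subst (_≤ f zero) eq (QP.p⊓q≤p _ _)
          ; (there y∈p) → z-min y∈p })

minH-<ₘ⁺ : ∀ {m} (f : Fin m → ℚ) {K S : Subset m} {w} → Nonempty S → w ∈ K →
  (∀ {y} → y ∈ S → f w < f y) → minH f K <ₘ minH f S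
minH-<ₘ⁺ f {K} {S} S≠∅ w∈K w<S with minH-spec f K | minH-spec f S
... | inj₁ (_ , K=∅) | _ = contradiction (_ , w∈K) K=∅
... | inj₂ _ | inj₁ (_ , S=∅) = contradiction S≠∅ S=∅
... | inj₂ (u , _ , mK , u-min) | inj₂ (z , z∈S , mS , _) =
  subst₂ _<ₘ_ (sym mK) (sym mS) (QP.≤-<-trans (u-min w∈K) (w<S z∈S))

minH-<ₘ⁻ : ∀ {m} (f : Fin m → ℚ) {K S : Subset m} {y} → minH f K <ₘ minH f S → y ∈ S →
  ∃[ w ] (w ∈ K × f w < f y)
minH-<ₘ⁻ f {K} {S} K<S y∈S with minH-spec f K | minH-spec f S
... | inj₁ (mK , _) | _ = contradiction (subst (_<ₘ minH f S) mK K<S) λ ()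
... | inj₂ _ | inj₁ (_ , S=∅) = contradiction (_ , y∈S) S=∅
... | inj₂ (u , u∈K , mK , _) | inj₂ (z , _ , mS , z-min) =
  u , u∈K , QP.<-≤-trans (subst₂ _<ₘ_ mK mS K<S) (z-min y∈S)

cover-below : ∀ {m} (𝒦 : Family m) {S K} → S ∈ᶠ 𝒦 → K ∈ᶠ 𝒦 → S ⊂ K →
  ∃[ K′ ] (Covers 𝒦 S K′ × K′ ⊆ K)
cover-below 𝒦 {S} {K} S∈𝒦 K∈𝒦 S⊂K with ⊂-minimal between? (K∈𝒦 , S⊂K , id)
  where between? = λ K′ → T? (𝒦 K′) ×-dec (S ⊂? K′ ×-dec K′ ⊆? K)
... | K′ , (K′∈𝒦 , S⊂K′ , K′⊆K) , minimal =
  K′ , (S∈𝒦 , K′∈𝒦 , S⊂K′ , λ K″ K″∈𝒦 S⊂K″ K″⊂K′ →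
          minimal (K″∈𝒦 , S⊂K″ , ⊆-trans (proj₁ K″⊂K′) K′⊆K) K″⊂K′) ,
  K′⊆K

module _ {m} {𝒞 𝒦 : Family m} (𝒞⊆𝒦 : 𝒞 ⊆ᶠ 𝒦) {h : Fin m → ℚ} where

  preIsland-⊂-lower : ∀ {S K y} → IsPreIsland 𝒞 𝒦 h S → K ∈ᶠ 𝒦 → S ⊂ K → y ∈ S →
    ∃[ w ] (w ∈ K × h w < h y)
  preIsland-⊂-lower (S∈𝒞 , _ , lower) K∈𝒦 S⊂K y∈S with cover-below 𝒦 (𝒞⊆𝒦 _ S∈𝒞) K∈𝒦 S⊂K
  ... | K′ , S≺K′@(_ , K′∈𝒦 , _) , K′⊆K with minH-<ₘ⁻ h (lower K′ K′∈𝒦 S≺K′) y∈S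
  ... | w , w∈K′ , hw<hy = w , K′⊆K w∈K′ , hw<hy

  preIsland-absorbs : IsConnective 𝒞 𝒦 → ∀ {S H x} → IsPreIsland 𝒞 𝒦 h S → H ∈ᶠ 𝒞 →
    x ∈ S → x ∈ H → (∀ {z} → z ∈ S → h x ≤ h z) → (∀ {z} → z ∈ H → h x ≤ h z) → H ⊆ S
  preIsland-absorbs connective {S} {H} S-pre H∈𝒞 x∈S x∈H x≤S x≤H with H ⊆? S
  ... | yes H⊆S = H⊆S
  ... | no H⊈S with connective S H (proj₁ S-pre) H∈𝒞 (_ , x∈p∩q⁺ (x∈S , x∈H)) H⊈S
  ...   | K , K∈𝒦 , S⊂K , K⊆S∪H with preIsland-⊂-lower S-pre K∈𝒦 S⊂K x∈S
  ...   | w , w∈K , hw<hx =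
    contradiction (QP.<-≤-trans hw<hx (Sum.[ x≤S , x≤H ] (x∈p∪q⁻ S H (K⊆S∪H w∈K))))
                  (QP.<-irrefl refl)

⊤-preIsland : ∀ {m} {𝒞 𝒦 : Family (suc m)} {h} → ⊤ ∈ᶠ 𝒞 → IsPreIsland 𝒞 𝒦 h ⊤
⊤-preIsland ⊤∈𝒞 =
  ⊤∈𝒞 , (zero , ∈⊤) , λ { _ _ (_ , _ , (_ , _ , _ , x∉⊤) , _) → contradiction ∈⊤ x∉⊤ }

preIslands⇒admissible : ∀ {m} {𝒞 𝒦 ℋ : Family (suc m)} →
  IsIslandDomain 𝒞 𝒦 → IsSystemOfPreIslands 𝒞 𝒦 ℋ → IsAdmissible 𝒞 𝒦 ℋ
preIslands⇒admissible {𝒞 = 𝒞} {𝒦} {ℋ} (𝒞⊆𝒦 , ⊤∈𝒞) (h , ℋ⇔preIslands) =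
  (λ S S∈ℋ → let (S∈𝒞 , S≠∅ , _) = preIsland S∈ℋ in S∈𝒞 , S≠∅) ,
  Equivalence.from (ℋ⇔preIslands ⊤) (⊤-preIsland {𝒞 = 𝒞} ⊤∈𝒞) ,
  unextendable
  where
  preIsland : ∀ {S} → S ∈ᶠ ℋ → IsPreIsland 𝒞 𝒦 h S
  preIsland = Equivalence.to (ℋ⇔preIslands _)

  unextendable : ∀ 𝒜 → 𝒜 ⊆ᶠ ℋ → IsAntichain 𝒜 → ∃[ A ] (A ∈ᶠ 𝒜) →
    ∃[ H ] (H ∈ᶠ 𝒜 × (∀ K → K ∈ᶠ 𝒦 → H ⊂ K → ¬ (K ⊆⋃ 𝒜)))
  unextendable 𝒜 𝒜⊆ℋ _ (A , A∈𝒜) with proj₁ (proj₂ (preIsland (𝒜⊆ℋ A A∈𝒜)))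
  ... | x , x∈A with minimiser h (λ y → anySubset? (λ B → T? (𝒜 B) ×-dec y ∈? B)) (x , A , A∈𝒜 , x∈A)
  ... | z , (H , H∈𝒜 , z∈H) , z-min = H , H∈𝒜 , λ K K∈𝒦 H⊂K K⊆⋃𝒜 →
    let (w , w∈K , hw<hz) = preIsland-⊂-lower 𝒞⊆𝒦 (preIsland (𝒜⊆ℋ H H∈𝒜)) K∈𝒦 H⊂K z∈H
    in QP.<-irrefl refl (QP.<-≤-trans hw<hz (z-min (K⊆⋃𝒜 w w∈K)))

_∈⋃_ : ∀ {m} → Fin m → List (Subset m) → Set
x ∈⋃ L = Any (x ∈_) L

Any-drop⁻ : ∀ {a p} {A : Set a} {P : Pred A p} (xs : List A) i → Any P (drop i xs) → Any P xs
Any-drop⁻ xs       zero    pxs = pxs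
Any-drop⁻ (_ ∷ xs) (suc i) pxs = there (Any-drop⁻ xs i pxs)

∈⇒drop≡∷ : ∀ {a} {A : Set a} {x : A} {xs} → x ∈ˡ xs → ∃₂ λ i ys → drop i xs ≡ x ∷ ys
∈⇒drop≡∷ {xs = _ ∷ xs} (here refl) = zero , xs , refl
∈⇒drop≡∷ (there x∈xs) with ∈⇒drop≡∷ x∈xs
... | i , ys , eq = suc i , ys , eq

drop≡∷⇒∈ : ∀ {a} {A : Set a} {x : A} {ys} (xs : List A) i → drop i xs ≡ x ∷ ys → x ∈ˡ xs
drop≡∷⇒∈ xs i eq = Any-drop⁻ xs i (subst (_ ∈ˡ_) (sym eq) (here refl))

-- The position of the last member of L that contains x (0 if there is none).
level : ∀ {m} → List (Subset m) → Fin m → ℕ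
level []      x = zero
level (_ ∷ R) x with Any.any? (x ∈?_) R
... | yes _ = suc (level R x)
... | no  _ = zero

level-attained : ∀ {m} (L : List (Subset m)) {x} → x ∈⋃ L →
  ∃₂ λ H R → drop (level L x) L ≡ H ∷ R × x ∈ H
level-attained (H ∷ R) {x} x∈⋃L with Any.any? (x ∈?_) R | x∈⋃L
... | yes x∈⋃R | _            = level-attained R x∈⋃R
... | no  _    | here x∈H     = H , R , refl , x∈H
... | no  x∉⋃R | there x∈⋃R   = contradiction x∈⋃R x∉⋃R

∈⋃-drop⇒≤level : ∀ {m} (L : List (Subset m)) i {x} → x ∈⋃ drop i L → i ℕ.≤ level L x
∈⋃-drop⇒≤level L       zero    _ = z≤n
∈⋃-drop⇒≤level (_ ∷ R) (suc i) {x} x∈⋃ with Any.any? (x ∈?_) R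
... | yes _    = s≤s (∈⋃-drop⇒≤level R i x∈⋃)
... | no  x∉⋃R = contradiction (Any-drop⁻ R i x∈⋃) x∉⋃R

drop≡∷⇒≤level : ∀ {m} (L : List (Subset m)) i {H R z} → drop i L ≡ H ∷ R → z ∈ H → i ℕ.≤ level L z
drop≡∷⇒≤level L i H∷R z∈H = ∈⋃-drop⇒≤level L i (subst (_ ∈⋃_) (sym H∷R) (here z∈H))

≤level⇒∈⋃-drop : ∀ {m} (L : List (Subset m)) i {x} → x ∈⋃ L → i ℕ.≤ level L x → x ∈⋃ drop i L
≤level⇒∈⋃-drop L       zero    x∈⋃L _ = x∈⋃L
≤level⇒∈⋃-drop (_ ∷ R) (suc i) {x} _ i<level with Any.any? (x ∈?_) R | i<level
... | yes x∈⋃R | s≤s i≤level = ≤level⇒∈⋃-drop R i x∈⋃R i≤level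

height : ℕ → ℚ
height k = fromℤ (+ k)

height-mono-< : ∀ {k l} → k ℕ.< l → height k < height l
height-mono-< {k} {l} k<l =
  *<* (subst₂ ℤ._<_ (sym (ℤP.*-identityʳ (+ k))) (sym (ℤP.*-identityʳ (+ l))) (+<+ k<l))

height-mono-≤ : ∀ {k l} → k ℕ.≤ l → height k ≤ height l
height-mono-≤ {k} {l} k≤l =
  *≤* (subst₂ ℤ._≤_ (sym (ℤP.*-identityʳ (+ k))) (sym (ℤP.*-identityʳ (+ l))) (+≤+ k≤l))

height-cancel-≤ : ∀ {k l} → height k ≤ height l → k ℕ.≤ l
height-cancel-≤ hk≤hl = ℕP.≮⇒≥ (λ l<k → QP.<-irrefl refl (QP.≤-<-trans hk≤hl (height-mono-< l<k)))

module _ {m} (𝒦 : Family m) where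

  Unextendable : Subset m → List (Subset m) → Set
  Unextendable H R = ∀ K → K ∈ᶠ 𝒦 → H ⊂ K → ∃[ x ] (x ∈ K × ¬ x ∈⋃ R)

  data Peeling : List (Subset m) → Set where
    []  : Peeling []
    _∷_ : ∀ {H R} → Unextendable H (H ∷ R) → Peeling R → Peeling (H ∷ R)

  peeling-drop : ∀ {L} → Peeling L → ∀ i {H R} → drop i L ≡ H ∷ R → Unextendable H (H ∷ R)
  peeling-drop (H-unext ∷ _) zero    refl = H-unext
  peeling-drop (_ ∷ peel)    (suc i) eq   = peeling-drop peel i eq

module _ {m} {𝒞 𝒦 : Family m} (𝒞⊆𝒦 : 𝒞 ⊆ᶠ 𝒦) (connective : IsConnective 𝒞 𝒦)
         {L : List (Subset m)} (peel : Peeling 𝒦 L) (L-covers : ∀ x → x ∈⋃ L)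
         (L⊆𝒞 : ∀ {S} → S ∈ˡ L → S ∈ᶠ 𝒞 × Nonempty S) where

  private
    h : Fin m → ℚ
    h = height ∘ level L

  member⇒preIsland : ∀ {S} → S ∈ˡ L → IsPreIsland 𝒞 𝒦 h S
  member⇒preIsland {S} S∈L with ∈⇒drop≡∷ S∈L | L⊆𝒞 S∈L
  ... | i , R , S∷R | S∈𝒞 , S≠∅ = S∈𝒞 , S≠∅ , λ K K∈𝒦 (_ , _ , S⊂K , _) → lower K∈𝒦 S⊂K
    where
    lower : ∀ {K} → K ∈ᶠ 𝒦 → S ⊂ K → minH h K <ₘ minH h S
    lower {K} K∈𝒦 S⊂K with peeling-drop 𝒦 peel i S∷R K K∈𝒦 S⊂K
    ... | w , w∈K , w∉⋃ =
      minH-<ₘ⁺ h S≠∅ w∈K (λ y∈S → height-mono-< (ℕP.<-≤-trans level<i (drop≡∷⇒≤level L i S∷R y∈S)))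
      where
      level<i : level L w ℕ.< i
      level<i = ℕP.≰⇒> (λ i≤ → w∉⋃ (subst (w ∈⋃_) S∷R (≤level⇒∈⋃-drop L i (L-covers w) i≤)))

  preIsland⇒member : ∀ {S} → IsPreIsland 𝒞 𝒦 h S → S ∈ˡ L
  preIsland⇒member {S} S-pre@(S∈𝒞 , S≠∅ , _) with minimiser h (_∈? S) S≠∅
  ... | x , x∈S , x-min with level-attained L (L-covers x)
  ... | H , R , H∷R , x∈H with S ≟ˢ H
  ... | yes refl = drop≡∷⇒∈ L (level L x) H∷R
  ... | no S≢H with peeling-drop 𝒦 peel (level L x) H∷R S (𝒞⊆𝒦 S S∈𝒞) (⊆∧≢⇒⊂ H⊆S (S≢H ∘ sym))
    where
    H∈𝒞 : H ∈ᶠ 𝒞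
    H∈𝒞 = proj₁ (L⊆𝒞 (drop≡∷⇒∈ L (level L x) H∷R))
    H⊆S : H ⊆ S
    H⊆S = preIsland-absorbs 𝒞⊆𝒦 connective S-pre H∈𝒞 x∈S x∈H x-min
            (λ z∈H → height-mono-≤ (drop≡∷⇒≤level L (level L x) H∷R z∈H))
  ... | w , w∈S , w∉⋃ =
    contradiction (subst (w ∈⋃_) H∷R (≤level⇒∈⋃-drop L _ (L-covers w) (height-cancel-≤ (x-min w∈S))))
                  w∉⋃

module _ {m} (Rl : List (Subset m)) where

  private
    maximal? : ∀ S → Dec (S ∈ˡ Rl × ¬ Any (S ⊂_) Rl)
    maximal? S = Any.any? (S ≟ˢ_) Rl ×-dec ¬? (Any.any? (S ⊂?_) Rl)

  maximals : Family m
  maximals S = ⌊ maximal? S ⌋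

  maximals⇒maximal : ∀ {M} → M ∈ᶠ maximals → M ∈ˡ Rl × ¬ Any (M ⊂_) Rl
  maximals⇒maximal {M} = toWitness {a? = maximal? M}

  maximals-antichain : IsAntichain maximals
  maximals-antichain A B A∈ B∈ A⊆B with A ≟ˢ B
  ... | yes A≡B = A≡B
  ... | no  A≢B =
    contradiction (lose (proj₁ (maximals⇒maximal B∈)) (⊆∧≢⇒⊂ A⊆B A≢B)) (proj₂ (maximals⇒maximal A∈))

  below-maximal : ∀ {Q} → Q ∈ˡ Rl → ∃[ M ] (M ∈ᶠ maximals × Q ⊆ M)
  below-maximal {Q} Q∈Rl with ⊂-maximal (λ M → Any.any? (M ≟ˢ_) Rl ×-dec Q ⊆? M) (Q∈Rl , id)
  ... | M , (M∈Rl , Q⊆M) , maximal = M , fromWitness {a? = maximal? M} (M∈Rl , M-maximal) , Q⊆M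
    where
    M-maximal : ¬ Any (M ⊂_) Rl
    M-maximal M⊂ with find M⊂
    ... | M′ , M′∈Rl , M⊂M′ = maximal (M′∈Rl , ⊆-trans Q⊆M (proj₁ M⊂M′)) M⊂M′

  ∈⋃⇒∈maximal : ∀ {x} → x ∈⋃ Rl → ∃[ M ] (M ∈ᶠ maximals × x ∈ M)
  ∈⋃⇒∈maximal x∈⋃ with find x∈⋃
  ... | Q , Q∈Rl , x∈Q with below-maximal Q∈Rl
  ... | M , M∈ , Q⊆M = M , M∈ , Q⊆M x∈Q

without : ∀ {m} → Subset m → List (Subset m) → List (Subset m)
without H = filter (λ S → ¬? (S ≟ˢ H))

module _ {m} {H : Subset m} {Rl : List (Subset m)} where

  length-without : H ∈ˡ Rl → length (without H Rl) ℕ.< length Rl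
  length-without H∈Rl = ListP.filter-notAll (λ S → ¬? (S ≟ˢ H)) Rl (lose H∈Rl (λ H≢H → H≢H refl))

  without⊆ : without H Rl ⊆ˡ Rl
  without⊆ = proj₁ ∘ ∈-filter⁻ (λ S → ¬? (S ≟ˢ H))

  ∈-without⁺ : ∀ {S} → S ∈ˡ Rl → S ≢ H → S ∈ˡ without H Rl
  ∈-without⁺ = ∈-filter⁺ (λ S → ¬? (S ≟ˢ H))

module _ {m} {𝒦 : Family m} {Rl : List (Subset m)} {H : Subset m} where

  peeling-cons : H ∈ᶠ maximals Rl → (∀ K → K ∈ᶠ 𝒦 → H ⊂ K → ¬ (K ⊆⋃ maximals Rl)) →
    ∃[ L ] (Peeling 𝒦 L × L ⊆ˡ without H Rl × without H Rl ⊆ˡ L) →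
    ∃[ L ] (Peeling 𝒦 L × L ⊆ˡ Rl × Rl ⊆ˡ L)
  peeling-cons H∈max H-unext (L , peel , L⊆ , ⊆L) = H ∷ L , unext ∷ peel , H∷L⊆Rl , Rl⊆H∷L
    where
    H∷L⊆Rl : H ∷ L ⊆ˡ Rl
    H∷L⊆Rl (here refl)  = proj₁ (maximals⇒maximal Rl H∈max)
    H∷L⊆Rl (there S∈L) = without⊆ (L⊆ S∈L)

    Rl⊆H∷L : Rl ⊆ˡ H ∷ L
    Rl⊆H∷L {S} S∈Rl with S ≟ˢ H
    ... | yes refl = here refl
    ... | no  S≢H  = there (⊆L (∈-without⁺ S∈Rl S≢H))

    unext : Unextendable 𝒦 H (H ∷ L)
    unext K K∈𝒦 H⊂K = ∃-counterexample (λ x → Any.any? (x ∈?_) (H ∷ L)) K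
      (λ K⊆⋃ → H-unext K K∈𝒦 H⊂K (λ x x∈K → ∈⋃⇒∈maximal Rl (Any-resp-⊆ H∷L⊆Rl (K⊆⋃ x x∈K))))

module _ {m} {𝒞 𝒦 ℋ : Family m} (adm : IsAdmissible 𝒞 𝒦 ℋ) where

  peeling-of : ∀ f (Rl : List (Subset m)) → length Rl ℕ.≤ f → (∀ {H} → H ∈ˡ Rl → H ∈ᶠ ℋ) →
    ∃[ L ] (Peeling 𝒦 L × L ⊆ˡ Rl × Rl ⊆ˡ L)
  peeling-of _ [] _ _ = [] , [] , id , id
  peeling-of (suc f) Rl@(_ ∷ _) |Rl|≤ Rl⊆ℋ
    with proj₂ (proj₂ adm) (maximals Rl) (λ _ M∈ → Rl⊆ℋ (proj₁ (maximals⇒maximal Rl M∈)))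
           (maximals-antichain Rl) (let (M , M∈ , _) = below-maximal Rl (here refl) in M , M∈)
  ... | H , H∈max , H-unext =
    peeling-cons H∈max H-unext (peeling-of f (without H Rl) shorter (Rl⊆ℋ ∘ without⊆))
    where
    shorter : length (without H Rl) ℕ.≤ f
    shorter = ℕP.≤-pred (ℕP.<-≤-trans (length-without (proj₁ (maximals⇒maximal Rl H∈max))) |Rl|≤)

  private
    ℋ? : Decidable (_∈ᶠ ℋ)
    ℋ? S = T? (ℋ S)

    members : List (Subset m)
    members = filter ℋ? (subsets m)

  admissible⇒peeling : ∃[ L ] (Peeling 𝒦 L × (∀ {H} → H ∈ˡ L → H ∈ᶠ ℋ) × (∀ {H} → H ∈ᶠ ℋ → H ∈ˡ L))
  admissible⇒peeling
    with peeling-of (length members) members ℕP.≤-refl (proj₂ ∘ ∈-filter⁻ ℋ? {xs = subsets m})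
  ... | L , peel , L⊆ , ⊆L =
    L , peel , proj₂ ∘ ∈-filter⁻ ℋ? {xs = subsets m} ∘ L⊆ , ⊆L ∘ ∈-filter⁺ ℋ? (∈-subsets _)

admissible⇒preIslands : ∀ {m} {𝒞 𝒦 ℋ : Family m} →
  IsIslandDomain 𝒞 𝒦 → IsConnective 𝒞 𝒦 → IsAdmissible 𝒞 𝒦 ℋ → IsSystemOfPreIslands 𝒞 𝒦 ℋ
admissible⇒preIslands {𝒞 = 𝒞} (𝒞⊆𝒦 , _) connective adm@(ℋ⊆𝒞 , ⊤∈ℋ , _) with admissible⇒peeling adm
... | L , peel , L⊆ℋ , ℋ⊆L = height ∘ level L , λ _ →
  mk⇔ (member⇒preIsland 𝒞⊆𝒦 connective peel L-covers L⊆𝒞 ∘ ℋ⊆L)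
      (L⊆ℋ ∘ preIsland⇒member 𝒞⊆𝒦 connective peel L-covers L⊆𝒞)
  where
  L-covers : ∀ x → x ∈⋃ L
  L-covers x = lose (ℋ⊆L ⊤∈ℋ) ∈⊤

  L⊆𝒞 : ∀ {S} → S ∈ˡ L → S ∈ᶠ 𝒞 × Nonempty S
  L⊆𝒞 = ℋ⊆𝒞 _ ∘ L⊆ℋ

theorem4p9 : (n : ℕ) (𝒞 𝒦 : Family (suc n)) →
    IsIslandDomain 𝒞 𝒦 → IsConnective 𝒞 𝒦 →
    (ℋ : Family (suc n)) → ℋ ⊆ᶠ 𝒞 →
    (IsSystemOfPreIslands 𝒞 𝒦 ℋ ⇔ IsAdmissible 𝒞 𝒦 ℋ)
-- The hypothesis ℋ ⊆ᶠ 𝒞 is implied by either side of the equivalence.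
theorem4p9 n 𝒞 𝒦 domain connective ℋ _ =
  mk⇔ (preIslands⇒admissible domain) (admissible⇒preIslands domain connective)
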